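{- For every integer $K$, every positive integer $e$ and every odd prime $p$, $\omega_K(p^e)=\omega_K(p)$.
   Context: For an integer $K$, the $K$-Fibonacci sequence is $F_{K,0}=0$, $F_{K,1}=1$, $F_{K,n}=KF_{K,n-1}+F_{K,n-2}$ for $n\ge2$. For an integer $m\ge 2$, $\pi_K(m)$ is the least positive period of $(F_{K,n}\bmod m)$ and $\omega_K(m)$ is the number of indices $0\le n<\pi_K(m)$ with $m\mid F_{K,n}$. -}

module Defs where

open import Data.Nat as ℕ using (ℕ; zero; suc; _<_; NonZero)
open import Data.Integer as ℤ using (ℤ; +_; _%ℕ_)
open import Data.Integer.Divisibility.Signed using (_∣_; _∣?_)
open import Data.Product using (_×_)
open import Relation.Binary.PropositionalEquality using (_≡_)
open import Relation.Nullary using (¬_; yes; no)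

F : ℤ → ℕ → ℤ
F K zero = + 0
F K (suc zero) = + 1
F K (suc (suc n)) = K ℤ.* F K (suc n) ℤ.+ F K n

IsPeriod : (K : ℤ) (m : ℕ) .{{_ : NonZero m}} → ℕ → Set
IsPeriod K m π = 0 < π × (∀ n → F K (n ℕ.+ π) %ℕ m ≡ F K n %ℕ m)

IsLeastPeriod : (K : ℤ) (m : ℕ) .{{_ : NonZero m}} → ℕ → Set
IsLeastPeriod K m π = IsPeriod K m π × (∀ π′ → π′ < π → ¬ IsPeriod K m π′)

countZeros : (K : ℤ) (m : ℕ) → ℕ → ℕ
countZeros K m zero = 0
countZeros K m (suc N) with (+ m) ∣? F K N
... | yes _ = suc (countZeros K m N)
... | no  _ = countZeros K m N

{-# OPTIONS --safe #-}
-- Let α be the rank of apparition of m (the least α > 0 with m ∣ F α) and μ = F (α + 1).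
-- Then F (jα + n) ≡ μ^j F n (mod m) and μ is invertible mod m, so the zeros of F mod m are
-- exactly the multiples of α, the least period is α · ord μ, and ω(m) = ord μ. Cassini's
-- identity gives μ² ≡ (-1)^α, so ord μ = 4 if α is odd, while for even α and m an odd prime
-- power μ ≡ ±1 and ord μ is 1 or 2 according to the sign.
-- The ranks α of p and β of p^e satisfy α ∣ β ∣ p^(e-1) α, the second because p^k ∣ F n
-- implies p^(k+1) ∣ F (p n). Hence β/α is odd, α and β have the same parity, and
-- μ_{p^e} ≡ μ_p^(β/α) ≡ μ_p (mod p), so the signs ±1 agree as well.
module Submission where

open import Data.Integer as ℤ
  using (ℤ; +_; _+_; _-_; _*_; -_; 0ℤ; 1ℤ; -1ℤ; _%ℕ_; _/ℕ_)
import Data.Integer.DivMod as ℤ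
import Data.Integer.Properties as ℤ
open import Data.Integer.Divisibility.Signed
  using (_∣_; divides; _∣?_; ∣-refl; ∣-trans; ∣⇒∣ᵤ; ∣ᵤ⇒∣;
         ∣m∣n⇒∣m+n; ∣m∣n⇒∣m-n; ∣m⇒∣-m; ∣n⇒∣m*n; ∣m⇒∣m*n)
open import Data.Integer.Tactic.RingSolver using (solve-∀)
open import Data.Nat as ℕ using (ℕ; zero; suc; _^_; _>_; _<_; _≤_; z≤n; s≤s; NonZero)
import Data.Nat.DivMod as ℕ
import Data.Nat.Divisibility as ℕ
import Data.Nat.Properties as ℕ
open import Data.Nat.Primality
  using (Prime; euclidsLemma; prime⇒irreducible; prime⇒nonZero; irreducible[2]; ¬prime[1]; prime[2])
open import Data.Product using (∃-syntax; _×_; _,_; proj₁; proj₂; map₂)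
open import Data.Sum using (_⊎_; inj₁; inj₂; [_,_]′)
open import Function using (_∘_; id)
open import Relation.Binary using (Setoid; IsEquivalence)
open import Relation.Binary.PropositionalEquality
  using (_≡_; _≢_; refl; sym; trans; cong; cong₂; subst; subst₂; module ≡-Reasoning)
open import Relation.Nullary using (¬_; yes; no; contradiction)
open import Relation.Nullary.Decidable using (_×-dec_)
open import Relation.Unary using (Decidable)

open import Defs

∣0 : ∀ {d} → d ∣ 0ℤ
∣0 {d} = divides 0ℤ (sym (ℤ.*-zeroˡ d))

infix 4 _≡_mod_

-- A record rather than a synonym for d ∣ a - b, so that a, b and d can be inferred.
record _≡_mod_ (a b d : ℤ) : Set where
  constructor mk≡mod
  field divides-difference : d ∣ a - b

module _ {d : ℤ} where

  ≡⇒≡mod : ∀ {a b} → a ≡ b → a ≡ b mod d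
  ≡⇒≡mod {a} refl = mk≡mod (subst (d ∣_) (sym (ℤ.+-inverseʳ a)) ∣0)

  ≡mod-refl : ∀ {a} → a ≡ a mod d
  ≡mod-refl = ≡⇒≡mod refl

  ≡mod-sym : ∀ {a b} → a ≡ b mod d → b ≡ a mod d
  ≡mod-sym {a} {b} (mk≡mod d∣a-b) = mk≡mod (subst (d ∣_) (identity a b) (∣m⇒∣-m d∣a-b))
    where
    identity : ∀ a b → - (a - b) ≡ b - a
    identity = solve-∀

  ≡mod-trans : ∀ {a b c} → a ≡ b mod d → b ≡ c mod d → a ≡ c mod d
  ≡mod-trans {a} {b} {c} (mk≡mod d∣a-b) (mk≡mod d∣b-c) =
    mk≡mod (subst (d ∣_) (identity a b c) (∣m∣n⇒∣m+n d∣a-b d∣b-c))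
    where
    identity : ∀ a b c → (a - b) + (b - c) ≡ a - c
    identity = solve-∀

  ≡mod-isEquivalence : IsEquivalence (λ a b → a ≡ b mod d)
  ≡mod-isEquivalence = record { refl = ≡mod-refl ; sym = ≡mod-sym ; trans = ≡mod-trans }

  +-cong : ∀ {a b a′ b′} → a ≡ a′ mod d → b ≡ b′ mod d → a + b ≡ a′ + b′ mod d
  +-cong {a} {b} {a′} {b′} (mk≡mod d∣a-a′) (mk≡mod d∣b-b′) =
    mk≡mod (subst (d ∣_) (identity a b a′ b′) (∣m∣n⇒∣m+n d∣a-a′ d∣b-b′))
    where
    identity : ∀ a b a′ b′ → (a - a′) + (b - b′) ≡ (a + b) - (a′ + b′)
    identity = solve-∀

  *-cong : ∀ {a b a′ b′} → a ≡ a′ mod d → b ≡ b′ mod d → a * b ≡ a′ * b′ mod d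
  *-cong {a} {b} {a′} {b′} (mk≡mod d∣a-a′) (mk≡mod d∣b-b′) =
    mk≡mod (subst (d ∣_) (identity a b a′ b′) (∣m∣n⇒∣m+n (∣m⇒∣m*n b d∣a-a′) (∣n⇒∣m*n a′ d∣b-b′)))
    where
    identity : ∀ a b a′ b′ → (a - a′) * b + a′ * (b - b′) ≡ a * b - a′ * b′
    identity = solve-∀

  *-congˡ : ∀ a {b b′} → b ≡ b′ mod d → a * b ≡ a * b′ mod d
  *-congˡ a = *-cong (≡mod-refl {a})

  *-congʳ : ∀ b {a a′} → a ≡ a′ mod d → a * b ≡ a′ * b mod d
  *-congʳ b a≡a′ = *-cong a≡a′ (≡mod-refl {b})

  ^-cong : ∀ n {a b} → a ≡ b mod d → a ℤ.^ n ≡ b ℤ.^ n mod d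
  ^-cong zero    a≡b = ≡mod-refl
  ^-cong (suc n) a≡b = *-cong a≡b (^-cong n a≡b)

  +-∣≡ : ∀ a {b} → d ∣ b → a + b ≡ a mod d
  +-∣≡ a {b} d∣b = mk≡mod (subst (d ∣_) (identity a b) d∣b)
    where
    identity : ∀ a b → b ≡ (a + b) - a
    identity = solve-∀

  ∣⇒≡0 : ∀ {a} → d ∣ a → a ≡ 0ℤ mod d
  ∣⇒≡0 {a} d∣a = mk≡mod (subst (d ∣_) (sym (ℤ.+-identityʳ a)) d∣a)

  ≡0⇒∣ : ∀ {a} → a ≡ 0ℤ mod d → d ∣ a
  ≡0⇒∣ {a} (mk≡mod d∣a-0) = subst (d ∣_) (ℤ.+-identityʳ a) d∣a-0

  ∣-resp-≡mod : ∀ {a b} → a ≡ b mod d → d ∣ a → d ∣ b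
  ∣-resp-≡mod a≡b d∣a = ≡0⇒∣ (≡mod-trans (≡mod-sym a≡b) (∣⇒≡0 d∣a))

≡mod-setoid : ℤ → Setoid _ _
≡mod-setoid d = record { isEquivalence = ≡mod-isEquivalence {d} }

module ≡mod-Reasoning (d : ℤ) where
  open import Relation.Binary.Reasoning.Setoid (≡mod-setoid d) public

≡mod-weaken : ∀ {d d′ a b} → d′ ∣ d → a ≡ b mod d → a ≡ b mod d′
≡mod-weaken d′∣d (mk≡mod d∣a-b) = mk≡mod (∣-trans d′∣d d∣a-b)

≡mod-scaleʳ : ∀ {d a b} c → a ≡ b mod d → a * c ≡ b * c mod d * c
≡mod-scaleʳ {d} {a} {b} c (mk≡mod (divides q a-b≡qd)) = mk≡mod (divides q (begin
  a * c - b * c  ≡⟨ identity a b c ⟩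
  (a - b) * c    ≡⟨ cong (_* c) a-b≡qd ⟩
  q * d * c      ≡⟨ ℤ.*-assoc q d c ⟩
  q * (d * c)    ∎))
  where
  open ≡-Reasoning
  identity : ∀ a b c → a * c - b * c ≡ (a - b) * c
  identity = solve-∀

∣∧<⇒≡0 : ∀ {m n} → m ℕ.∣ n → n < m → n ≡ 0
∣∧<⇒≡0 {n = zero}  _   _   = refl
∣∧<⇒≡0 {n = suc _} m∣n n<m = contradiction m∣n (ℕ.>⇒∤ n<m)

module _ {m : ℕ} .{{_ : NonZero m}} where

  ≡%ℕ : ∀ a → a ≡ + (a %ℕ m) mod + m
  ≡%ℕ a = begin
    a                              ≡⟨ ℤ.a≡a%ℕn+[a/ℕn]*n a m ⟩
    + (a %ℕ m) + (a /ℕ m) * + m    ≈⟨ +-∣≡ (+ (a %ℕ m)) (∣n⇒∣m*n (a /ℕ m) ∣-refl) ⟩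
    + (a %ℕ m)                     ∎
    where open ≡mod-Reasoning (+ m)

  ≥-≡mod⇒≡ : ∀ {x y} → y ≤ x → x < m → + x ≡ + y mod + m → x ≡ y
  ≥-≡mod⇒≡ {x} {y} y≤x x<m (mk≡mod m∣x-y) = ℕ.≤-antisym (ℕ.m∸n≡0⇒m≤n x∸y≡0) y≤x
    where
    m∣x∸y : m ℕ.∣ x ℕ.∸ y
    m∣x∸y = ∣⇒∣ᵤ (subst (+ m ∣_) (trans (ℤ.[+m]-[+n]≡m⊖n x y) (ℤ.⊖-≥ y≤x)) m∣x-y)
    x∸y≡0 : x ℕ.∸ y ≡ 0
    x∸y≡0 = ∣∧<⇒≡0 m∣x∸y (ℕ.≤-<-trans (ℕ.m∸n≤m x y) x<m)

  <-≡mod⇒≡ : ∀ {x y} → x < m → y < m → + x ≡ + y mod + m → x ≡ y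
  <-≡mod⇒≡ {x} {y} x<m y<m x≡y with ℕ.≤-total y x
  ... | inj₁ y≤x = ≥-≡mod⇒≡ y≤x x<m x≡y
  ... | inj₂ x≤y = sym (≥-≡mod⇒≡ x≤y y<m (≡mod-sym x≡y))

  ≡mod⇒%ℕ≡ : ∀ {a b} → a ≡ b mod + m → a %ℕ m ≡ b %ℕ m
  ≡mod⇒%ℕ≡ {a} {b} a≡b = <-≡mod⇒≡ (ℤ.n%ℕd<d a m) (ℤ.n%ℕd<d b m) (begin
    + (a %ℕ m)  ≈⟨ ≡%ℕ a ⟨
    a           ≈⟨ a≡b ⟩
    b           ≈⟨ ≡%ℕ b ⟩
    + (b %ℕ m)  ∎)
    where open ≡mod-Reasoning (+ m)

  %ℕ≡⇒≡mod : ∀ {a b} → a %ℕ m ≡ b %ℕ m → a ≡ b mod + m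
  %ℕ≡⇒≡mod {a} {b} a%m≡b%m = begin
    a           ≈⟨ ≡%ℕ a ⟩
    + (a %ℕ m)  ≡⟨ cong +_ a%m≡b%m ⟩
    + (b %ℕ m)  ≈⟨ ≡%ℕ b ⟨
    b           ∎
    where open ≡mod-Reasoning (+ m)

F-+ : ∀ K m n → F K (m ℕ.+ suc n) ≡ F K (suc m) * F K (suc n) + F K m * F K n
F-+ K zero    n = identity (F K (suc n)) (F K n)
  where
  identity : ∀ x y → x ≡ + 1 * x + + 0 * y
  identity = solve-∀
F-+ K (suc m) n = begin
  F K (suc (m ℕ.+ suc n))                                     ≡⟨ cong (F K) (ℕ.+-suc m (suc n)) ⟨
  F K (m ℕ.+ suc (suc n))                                     ≡⟨ F-+ K m (suc n) ⟩
  F K (suc m) * (K * F K (suc n) + F K n) + F K m * F K (suc n)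
    ≡⟨ identity K (F K (suc m)) (F K m) (F K (suc n)) (F K n) ⟩
  (K * F K (suc m) + F K m) * F K (suc n) + F K (suc m) * F K n ∎
  where
  open ≡-Reasoning
  identity : ∀ K a b x y → a * (K * x + y) + b * x ≡ (K * a + b) * x + a * y
  identity = solve-∀

F-cassini : ∀ K n → F K (suc n) * F K (suc n) - F K (suc (suc n)) * F K n ≡ -1ℤ ℤ.^ n
F-cassini K zero    = identity K
  where
  identity : ∀ K → + 1 * + 1 - (K * + 1 + + 0) * + 0 ≡ + 1
  identity = solve-∀
F-cassini K (suc n) = trans (identity K (F K (suc n)) (F K n)) (cong (-1ℤ *_) (F-cassini K n))
  where
  identity : ∀ K x y → (K * x + y) * (K * x + y) - (K * (K * x + y) + x) * x
                       ≡ -1ℤ * (x * x - (K * x + y) * y)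
  identity = solve-∀

-1^n≡1⊎-1^n≡-1 : ∀ n → -1ℤ ℤ.^ n ≡ 1ℤ ⊎ -1ℤ ℤ.^ n ≡ -1ℤ
-1^n≡1⊎-1^n≡-1 zero = inj₁ refl
-1^n≡1⊎-1^n≡-1 (suc n) with -1^n≡1⊎-1^n≡-1 n
... | inj₁ -1^n≡1  = inj₂ (cong (-1ℤ *_) -1^n≡1)
... | inj₂ -1^n≡-1 = inj₁ (cong (-1ℤ *_) -1^n≡-1)

-1^n*-1^n≡1 : ∀ n → -1ℤ ℤ.^ n * -1ℤ ℤ.^ n ≡ 1ℤ
-1^n*-1^n≡1 zero    = refl
-1^n*-1^n≡1 (suc n) = trans (identity (-1ℤ ℤ.^ n)) (-1^n*-1^n≡1 n)
  where
  identity : ∀ s → (-1ℤ * s) * (-1ℤ * s) ≡ s * s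
  identity = solve-∀

-1^odd≡-1 : ∀ c → -1ℤ ℤ.^ suc (c ℕ.* 2) ≡ -1ℤ
-1^odd≡-1 zero    = refl
-1^odd≡-1 (suc c) = trans (identity (-1ℤ ℤ.^ suc (c ℕ.* 2))) (-1^odd≡-1 c)
  where
  identity : ∀ s → -1ℤ * (-1ℤ * s) ≡ s
  identity = solve-∀

-1^[odd*n]≡-1^n : ∀ c n → -1ℤ ℤ.^ (suc (c ℕ.* 2) ℕ.* n) ≡ -1ℤ ℤ.^ n
-1^[odd*n]≡-1^n c n = trans (sym (ℤ.^-*-assoc -1ℤ (suc (c ℕ.* 2)) n)) (cong (ℤ._^ n) (-1^odd≡-1 c))

^-odd : ∀ {d x} → x * x ≡ 1ℤ mod d → ∀ c → x ℤ.^ suc (c ℕ.* 2) ≡ x mod d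
^-odd {d} {x} x²≡1 zero    = ≡⇒≡mod (ℤ.*-identityʳ x)
^-odd {d} {x} x²≡1 (suc c) = begin
  x * (x * x ℤ.^ suc (c ℕ.* 2))  ≡⟨ ℤ.*-assoc x x _ ⟨
  (x * x) * x ℤ.^ suc (c ℕ.* 2)  ≈⟨ *-cong x²≡1 (^-odd x²≡1 c) ⟩
  1ℤ * x                         ≡⟨ ℤ.*-identityˡ x ⟩
  x                              ∎
  where open ≡mod-Reasoning d

record IsOrder (d x : ℤ) (ω : ℕ) : Set where
  field
    positive : 0 < ω
    pow≡1    : x ℤ.^ ω ≡ 1ℤ mod d
    least    : ∀ {j} → 0 < j → j < ω → ¬ (x ℤ.^ j ≡ 1ℤ mod d)

module _ {d : ℤ} where
  open ≡mod-Reasoning d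

  ≡1⇒IsOrder1 : ∀ {x} → x ≡ 1ℤ mod d → IsOrder d x 1
  ≡1⇒IsOrder1 {x} x≡1 = record
    { positive = s≤s z≤n
    ; pow≡1    = ≡mod-trans (≡⇒≡mod (ℤ.*-identityʳ x)) x≡1
    ; least    = λ 0<j j<1 → contradiction 0<j (ℕ.<⇒≱ j<1)
    }

  module _ (d∤2 : ¬ (d ∣ + 2)) where

    1≢-1 : ¬ (1ℤ ≡ -1ℤ mod d)
    1≢-1 (mk≡mod d∣2) = d∤2 d∣2

    ≡-1⇒IsOrder2 : ∀ {x} → x ≡ -1ℤ mod d → IsOrder d x 2
    ≡-1⇒IsOrder2 {x} x≡-1 = record { positive = s≤s z≤n ; pow≡1 = ^-cong 2 x≡-1 ; least = least }
      where
      least : ∀ {j} → 0 < j → j < 2 → ¬ (x ℤ.^ j ≡ 1ℤ mod d)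
      least {1} _ _ x¹≡1 = 1≢-1 (begin
        1ℤ      ≈⟨ x¹≡1 ⟨
        x * 1ℤ  ≡⟨ ℤ.*-identityʳ x ⟩
        x       ≈⟨ x≡-1 ⟩
        -1ℤ     ∎)
      least {suc (suc _)} _ (s≤s (s≤s ()))

    square≡-1⇒IsOrder4 : ∀ {x} → x * x ≡ -1ℤ mod d → IsOrder d x 4
    square≡-1⇒IsOrder4 {x} x²≡-1 = record { positive = s≤s z≤n ; pow≡1 = x⁴≡1 ; least = least }
      where
      x⁴≡1 : x ℤ.^ 4 ≡ 1ℤ mod d
      x⁴≡1 = begin
        x ℤ.^ 4            ≡⟨ identity x ⟩
        (x * x) * (x * x)  ≈⟨ *-cong x²≡-1 x²≡-1 ⟩
        1ℤ                 ∎
        where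
        identity : ∀ x → x * (x * (x * (x * + 1))) ≡ (x * x) * (x * x)
        identity = solve-∀
      x≢1 : ¬ (x ≡ 1ℤ mod d)
      x≢1 x≡1 = 1≢-1 (begin
        1ℤ     ≈⟨ *-cong x≡1 x≡1 ⟨
        x * x  ≈⟨ x²≡-1 ⟩
        -1ℤ    ∎)
      least : ∀ {j} → 0 < j → j < 4 → ¬ (x ℤ.^ j ≡ 1ℤ mod d)
      least {1} _ _ x¹≡1 = x≢1 (≡mod-trans (≡⇒≡mod (sym (ℤ.*-identityʳ x))) x¹≡1)
      least {2} _ _ x²≡1 = 1≢-1 (begin
        1ℤ            ≈⟨ x²≡1 ⟨
        x * (x * 1ℤ)  ≡⟨ cong (x *_) (ℤ.*-identityʳ x) ⟩
        x * x         ≈⟨ x²≡-1 ⟩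
        -1ℤ           ∎)
      least {3} _ _ x³≡1 = x≢1 (begin
        x              ≡⟨ ℤ.*-identityʳ x ⟨
        x * 1ℤ         ≈⟨ *-congˡ x x³≡1 ⟨
        x * x ℤ.^ 3    ≈⟨ x⁴≡1 ⟩
        1ℤ             ∎)
      least {suc (suc (suc (suc _)))} _ (s≤s (s≤s (s≤s (s≤s ()))))

prime^∣*⇒∣ : ∀ {p} → Prime p → ∀ k {a b} → ¬ (p ℕ.∣ a) → p ^ k ℕ.∣ a ℕ.* b → p ^ k ℕ.∣ b
prime^∣*⇒∣ _ zero {b = b} _ _ = ℕ.1∣ b
prime^∣*⇒∣ {p} p-prime (suc k) {a} {b} p∤a pᵏ⁺¹∣ab
  with euclidsLemma a b p-prime (ℕ.m*n∣⇒m∣ p (p ^ k) pᵏ⁺¹∣ab)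
... | inj₁ p∣a = contradiction p∣a p∤a
... | inj₂ (ℕ.divides b′ refl) = subst (ℕ._∣ b′ ℕ.* p) (ℕ.*-comm (p ^ k) p) (ℕ.*-monoˡ-∣ p pᵏ∣b′)
  where
  instance _ = prime⇒nonZero p-prime
  pᵏ∣b′ : p ^ k ℕ.∣ b′
  pᵏ∣b′ = prime^∣*⇒∣ p-prime k p∤a (ℕ.*-cancelʳ-∣ p
            (subst₂ ℕ._∣_ (ℕ.*-comm p (p ^ k)) (sym (ℕ.*-assoc a b′ p)) pᵏ⁺¹∣ab))

prime^∣*⇒∣ℤ : ∀ {p} → Prime p → ∀ k {a b} → ¬ (+ p ∣ a) → + (p ^ k) ∣ a * b → + (p ^ k) ∣ b
prime^∣*⇒∣ℤ p-prime k {a} {b} p∤a pᵏ∣ab =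
  ∣ᵤ⇒∣ (prime^∣*⇒∣ p-prime k (p∤a ∘ ∣ᵤ⇒∣) (subst (_ ℕ.∣_) (ℤ.abs-* a b) (∣⇒∣ᵤ pᵏ∣ab)))

square≡1⇒≡±1 : ∀ {p} → Prime p → ¬ (+ p ∣ + 2) → ∀ k {x} →
               x * x ≡ 1ℤ mod + (p ^ k) → x ≡ 1ℤ mod + (p ^ k) ⊎ x ≡ -1ℤ mod + (p ^ k)
square≡1⇒≡±1 {p} p-prime p∤2 k {x} (mk≡mod pᵏ∣x²-1) with + p ∣? x - 1ℤ
... | yes p∣x-1 = inj₁ (mk≡mod (prime^∣*⇒∣ℤ p-prime k p∤x+1 (subst (_ ∣_) (x²-1≡[x+1][x-1] x) pᵏ∣x²-1)))
  where
  p∤x+1 : ¬ (+ p ∣ x - -1ℤ)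
  p∤x+1 p∣x+1 = p∤2 (subst (+ p ∣_) (difference x) (∣m∣n⇒∣m-n p∣x+1 p∣x-1))
    where
    difference : ∀ x → (x - -1ℤ) - (x - 1ℤ) ≡ + 2
    difference = solve-∀
  x²-1≡[x+1][x-1] : ∀ x → x * x - 1ℤ ≡ (x - -1ℤ) * (x - 1ℤ)
  x²-1≡[x+1][x-1] = solve-∀
... | no p∤x-1 = inj₂ (mk≡mod (prime^∣*⇒∣ℤ p-prime k p∤x-1 (subst (_ ∣_) (x²-1≡[x-1][x+1] x) pᵏ∣x²-1)))
  where
  x²-1≡[x-1][x+1] : ∀ x → x * x - 1ℤ ≡ (x - 1ℤ) * (x - -1ℤ)
  x²-1≡[x-1][x+1] = solve-∀

F-shift-by-zero : ∀ K a {d} → d ∣ F K a → ∀ n → F K (a ℕ.+ n) ≡ F K (suc a) * F K n mod d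
F-shift-by-zero K a {d} d∣Fa zero = begin
  F K (a ℕ.+ 0)       ≡⟨ cong (F K) (ℕ.+-identityʳ a) ⟩
  F K a               ≈⟨ ∣⇒≡0 d∣Fa ⟩
  0ℤ                  ≡⟨ ℤ.*-zeroʳ (F K (suc a)) ⟨
  F K (suc a) * 0ℤ    ∎
  where open ≡mod-Reasoning d
F-shift-by-zero K a {d} d∣Fa (suc n) = begin
  F K (a ℕ.+ suc n)                              ≡⟨ F-+ K a n ⟩
  F K (suc a) * F K (suc n) + F K a * F K n      ≈⟨ +-∣≡ _ (∣m⇒∣m*n (F K n) d∣Fa) ⟩
  F K (suc a) * F K (suc n)                      ∎
  where open ≡mod-Reasoning d

record IsRankOfApparition (K : ℤ) (m α : ℕ) : Set where
  field
    positive : 0 < α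
    ∣F       : + m ∣ F K α
    least    : ∀ {r} → 0 < r → r < α → ¬ (+ m ∣ F K r)

Least : (ℕ → Set) → ℕ → Set
Least P k = P k × (∀ {j} → j < k → ¬ P j)

least-or-none-below : ∀ {P : ℕ → Set} → Decidable P → ∀ N →
                      (∃[ k ] Least P k) ⊎ (∀ {j} → j < N → ¬ P j)
least-or-none-below P? zero = inj₂ λ ()
least-or-none-below P? (suc N) with least-or-none-below P? N | P? N
... | inj₁ least | _      = inj₁ least
... | inj₂ none  | yes PN = inj₁ (N , PN , none)
... | inj₂ none  | no ¬PN = inj₂ λ j<1+N → [ none , (λ { refl → ¬PN }) ]′ (ℕ.m<1+n⇒m<n∨m≡n j<1+N)

least-witness : ∀ {P : ℕ → Set} → Decidable P → ∀ {n} → P n → ∃[ k ] Least P k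
least-witness P? {n} Pn =
  [ id , (λ none → contradiction Pn (none (ℕ.n<1+n n))) ]′ (least-or-none-below P? (suc n))

rankOfApparition-exists : ∀ {K m n} → 0 < n → + m ∣ F K n → ∃[ α ] IsRankOfApparition K m α
rankOfApparition-exists {K} {m} 0<n m∣Fn
  with least-witness (λ r → (0 ℕ.<? r) ×-dec (+ m ∣? F K r)) (0<n , m∣Fn)
... | α , (0<α , m∣Fα) , below = α , record
  { positive = 0<α
  ; ∣F       = m∣Fα
  ; least    = λ 0<r r<α m∣Fr → below r<α (0<r , m∣Fr)
  }

module _ {K : ℤ} {m π : ℕ} .{{_ : NonZero m}} (period : IsPeriod K m π) where

  period⇒∣F : + m ∣ F K π
  period⇒∣F = ≡0⇒∣ (%ℕ≡⇒≡mod (proj₂ period 0))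

  period⇒F[1+π]≡1 : F K (suc π) ≡ 1ℤ mod + m
  period⇒F[1+π]≡1 = %ℕ≡⇒≡mod (proj₂ period 1)

  period⇒rankOfApparition : ∃[ α ] IsRankOfApparition K m α
  period⇒rankOfApparition = rankOfApparition-exists (proj₁ period) period⇒∣F

countZeros-suc-∣ : ∀ {K m N} → + m ∣ F K N → countZeros K m (suc N) ≡ suc (countZeros K m N)
countZeros-suc-∣ {K} {m} {N} m∣FN with + m ∣? F K N
... | yes _   = refl
... | no m∤FN = contradiction m∣FN m∤FN

countZeros-suc-∤ : ∀ {K m N} → ¬ (+ m ∣ F K N) → countZeros K m (suc N) ≡ countZeros K m N
countZeros-suc-∤ {K} {m} {N} m∤FN with + m ∣? F K N
... | yes m∣FN = contradiction m∣FN m∤FN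
... | no _     = refl

module RankOfApparition {K : ℤ} {m α : ℕ} (rank : IsRankOfApparition K m α) where
  open IsRankOfApparition rank

  multiplier : ℤ
  multiplier = F K (suc α)

  multiplier-square : multiplier * multiplier ≡ -1ℤ ℤ.^ α mod + m
  multiplier-square = begin
    multiplier * multiplier
      ≈⟨ +-∣≡ _ (∣m⇒∣-m (∣n⇒∣m*n (F K (suc (suc α))) ∣F)) ⟨
    multiplier * multiplier - F K (suc (suc α)) * F K α
      ≡⟨ F-cassini K α ⟩
    -1ℤ ℤ.^ α ∎
    where open ≡mod-Reasoning (+ m)

  multiplier-cancel : ∀ {x} → + m ∣ multiplier * x → + m ∣ x
  multiplier-cancel {x} m∣μx = ≡0⇒∣ (begin
    x                  ≡⟨ trans (cong (_* x) (-1^n*-1^n≡1 α)) (ℤ.*-identityˡ x) ⟨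
    (s * s) * x        ≈⟨ *-congʳ x (*-congʳ s multiplier-square) ⟨
    ((μ * μ) * s) * x  ≡⟨ identity μ s x ⟩
    (μ * s) * (μ * x)  ≈⟨ *-congˡ (μ * s) (∣⇒≡0 m∣μx) ⟩
    (μ * s) * 0ℤ       ≡⟨ ℤ.*-zeroʳ (μ * s) ⟩
    0ℤ                 ∎)
    where
    open ≡mod-Reasoning (+ m)
    μ = multiplier
    s = -1ℤ ℤ.^ α
    identity : ∀ μ s x → ((μ * μ) * s) * x ≡ (μ * s) * (μ * x)
    identity = solve-∀

  multiplier^-cancel : ∀ j {x} → + m ∣ multiplier ℤ.^ j * x → + m ∣ x
  multiplier^-cancel zero    {x} m∣x   = subst (+ m ∣_) (ℤ.*-identityˡ x) m∣x
  multiplier^-cancel (suc j) {x} m∣μʲ⁺¹x =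
    multiplier^-cancel j (multiplier-cancel (subst (+ m ∣_) (ℤ.*-assoc multiplier _ x) m∣μʲ⁺¹x))

  F-shift : ∀ j n → F K (j ℕ.* α ℕ.+ n) ≡ multiplier ℤ.^ j * F K n mod + m
  F-shift zero    n = ≡⇒≡mod (sym (ℤ.*-identityˡ (F K n)))
  F-shift (suc j) n = begin
    F K (suc j ℕ.* α ℕ.+ n)                      ≡⟨ cong (F K) (ℕ.+-assoc α (j ℕ.* α) n) ⟩
    F K (α ℕ.+ (j ℕ.* α ℕ.+ n))                  ≈⟨ F-shift-by-zero K α ∣F (j ℕ.* α ℕ.+ n) ⟩
    multiplier * F K (j ℕ.* α ℕ.+ n)             ≈⟨ *-congˡ multiplier (F-shift j n) ⟩
    multiplier * (multiplier ℤ.^ j * F K n)      ≡⟨ ℤ.*-assoc multiplier _ (F K n) ⟨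
    multiplier ℤ.^ suc j * F K n                 ∎
    where open ≡mod-Reasoning (+ m)

  F[1+jα]≡multiplier^j : ∀ j → F K (suc (j ℕ.* α)) ≡ multiplier ℤ.^ j mod + m
  F[1+jα]≡multiplier^j j = begin
    F K (suc (j ℕ.* α))     ≡⟨ cong (F K) (ℕ.+-comm 1 (j ℕ.* α)) ⟩
    F K (j ℕ.* α ℕ.+ 1)     ≈⟨ F-shift j 1 ⟩
    multiplier ℤ.^ j * + 1  ≡⟨ ℤ.*-identityʳ (multiplier ℤ.^ j) ⟩
    multiplier ℤ.^ j        ∎
    where open ≡mod-Reasoning (+ m)

  ∣F-shift⇒∣F : ∀ j n → + m ∣ F K (j ℕ.* α ℕ.+ n) → + m ∣ F K n
  ∣F-shift⇒∣F j n m∣F = multiplier^-cancel j (∣-resp-≡mod (F-shift j n) m∣F)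

  ∣⇒∣F : ∀ {n} → α ℕ.∣ n → + m ∣ F K n
  ∣⇒∣F (ℕ.divides j refl) = ≡0⇒∣ (begin
    F K (j ℕ.* α)              ≡⟨ cong (F K) (ℕ.+-identityʳ (j ℕ.* α)) ⟨
    F K (j ℕ.* α ℕ.+ 0)        ≈⟨ F-shift j 0 ⟩
    multiplier ℤ.^ j * 0ℤ      ≡⟨ ℤ.*-zeroʳ (multiplier ℤ.^ j) ⟩
    0ℤ                         ∎)
    where open ≡mod-Reasoning (+ m)

  ∣F⇒∣ : ∀ {n} → + m ∣ F K n → α ℕ.∣ n
  ∣F⇒∣ {n} m∣Fn = ℕ.m%n≡0⇒n∣m n α (∣F-below⇒≡0 (ℕ.m%n<n n α) m∣Fr)
    where
    instance _ = ℕ.>-nonZero positive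
    n≡qα+r : n ≡ n ℕ./ α ℕ.* α ℕ.+ n ℕ.% α
    n≡qα+r = trans (ℕ.m≡m%n+[m/n]*n n α) (ℕ.+-comm (n ℕ.% α) _)
    m∣Fr : + m ∣ F K (n ℕ.% α)
    m∣Fr = ∣F-shift⇒∣F (n ℕ./ α) (n ℕ.% α) (subst (λ t → + m ∣ F K t) n≡qα+r m∣Fn)
    ∣F-below⇒≡0 : ∀ {r} → r < α → + m ∣ F K r → r ≡ 0
    ∣F-below⇒≡0 {zero}  _   _    = refl
    ∣F-below⇒≡0 {suc r} r<α m∣Fr = contradiction m∣Fr (least (s≤s z≤n) r<α)

  countZeros-block : ∀ j r → r < α →
                     countZeros K m (suc (j ℕ.* α ℕ.+ r)) ≡ suc (countZeros K m (j ℕ.* α))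
  countZeros-block j zero    _   = begin
    countZeros K m (suc (j ℕ.* α ℕ.+ 0))
      ≡⟨ countZeros-suc-∣ (∣⇒∣F (ℕ.divides j (ℕ.+-identityʳ (j ℕ.* α)))) ⟩
    suc (countZeros K m (j ℕ.* α ℕ.+ 0))
      ≡⟨ cong (suc ∘ countZeros K m) (ℕ.+-identityʳ (j ℕ.* α)) ⟩
    suc (countZeros K m (j ℕ.* α))
      ∎
    where open ≡-Reasoning
  countZeros-block j (suc r) r<α = begin
    countZeros K m (suc (j ℕ.* α ℕ.+ suc r))
      ≡⟨ countZeros-suc-∤ (least (s≤s z≤n) r<α ∘ ∣F-shift⇒∣F j (suc r)) ⟩
    countZeros K m (j ℕ.* α ℕ.+ suc r)
      ≡⟨ cong (countZeros K m) (ℕ.+-suc (j ℕ.* α) r) ⟩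
    countZeros K m (suc (j ℕ.* α ℕ.+ r))
      ≡⟨ countZeros-block j r (ℕ.<-trans (ℕ.n<1+n r) r<α) ⟩
    suc (countZeros K m (j ℕ.* α))
      ∎
    where open ≡-Reasoning

  countZeros-multiple : ∀ j → countZeros K m (j ℕ.* α) ≡ j
  countZeros-multiple zero    = refl
  countZeros-multiple (suc j) = begin
    countZeros K m (suc j ℕ.* α)                    ≡⟨ cong (countZeros K m) (α+jα≡1+jα+[α-1]) ⟩
    countZeros K m (suc (j ℕ.* α ℕ.+ ℕ.pred α))     ≡⟨ countZeros-block j (ℕ.pred α) α-1<α ⟩
    suc (countZeros K m (j ℕ.* α))                  ≡⟨ cong suc (countZeros-multiple j) ⟩
    suc j                                           ∎
    where
    open ≡-Reasoning
    instance _ = ℕ.>-nonZero positive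
    α-1<α : ℕ.pred α < α
    α-1<α = subst (ℕ.pred α <_) (ℕ.suc-pred α) (ℕ.n<1+n (ℕ.pred α))
    α+jα≡1+jα+[α-1] : α ℕ.+ j ℕ.* α ≡ suc (j ℕ.* α ℕ.+ ℕ.pred α)
    α+jα≡1+jα+[α-1] = begin
      α ℕ.+ j ℕ.* α                 ≡⟨ ℕ.+-comm α (j ℕ.* α) ⟩
      j ℕ.* α ℕ.+ α                 ≡⟨ cong (j ℕ.* α ℕ.+_) (ℕ.suc-pred α) ⟨
      j ℕ.* α ℕ.+ suc (ℕ.pred α)    ≡⟨ ℕ.+-suc (j ℕ.* α) (ℕ.pred α) ⟩
      suc (j ℕ.* α ℕ.+ ℕ.pred α)    ∎

  module _ .{{_ : NonZero m}} {ω : ℕ} (order : IsOrder (+ m) multiplier ω) where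
    open IsOrder order renaming (positive to ω-positive; least to ω-least)

    order⇒period : IsPeriod K m (ω ℕ.* α)
    order⇒period = ℕ.<-≤-trans positive (ℕ.m≤n*m α ω) , λ n → ≡mod⇒%ℕ≡ (begin
      F K (n ℕ.+ ω ℕ.* α)           ≡⟨ cong (F K) (ℕ.+-comm n (ω ℕ.* α)) ⟩
      F K (ω ℕ.* α ℕ.+ n)           ≈⟨ F-shift ω n ⟩
      multiplier ℤ.^ ω * F K n      ≈⟨ *-congʳ (F K n) pow≡1 ⟩
      1ℤ * F K n                    ≡⟨ ℤ.*-identityˡ (F K n) ⟩
      F K n                         ∎)
      where
      open ≡mod-Reasoning (+ m)
      instance _ = ℕ.>-nonZero ω-positive

    leastPeriod≡order*rank : ∀ {π} → IsLeastPeriod K m π → π ≡ ω ℕ.* α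
    leastPeriod≡order*rank {π} (period , minimal) with ∣F⇒∣ (period⇒∣F period)
    ... | ℕ.divides q π≡qα = ℕ.≤-antisym π≤ωα ωα≤π
      where
      π≤ωα : π ≤ ω ℕ.* α
      π≤ωα = ℕ.≮⇒≥ (λ ωα<π → minimal (ω ℕ.* α) ωα<π order⇒period)
      μ^q≡1 : multiplier ℤ.^ q ≡ 1ℤ mod + m
      μ^q≡1 = ≡mod-trans (≡mod-sym (F[1+jα]≡multiplier^j q))
                (subst (λ i → F K (suc i) ≡ 1ℤ mod + m) π≡qα (period⇒F[1+π]≡1 period))
      0<q : 0 < q
      0<q = ℕ.>-nonZero⁻¹ q ⦃ ℕ.m*n≢0⇒m≢0 q ⦃ subst NonZero π≡qα (ℕ.>-nonZero (proj₁ period)) ⦄ ⦄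
      ωα≤π : ω ℕ.* α ≤ π
      ωα≤π = subst (ω ℕ.* α ≤_) (sym π≡qα) (ℕ.*-monoˡ-≤ α (ℕ.≮⇒≥ (λ q<ω → ω-least 0<q q<ω μ^q≡1)))

    zeros-per-period : ∀ {π} → IsLeastPeriod K m π → countZeros K m π ≡ ω
    zeros-per-period leastPeriod =
      trans (cong (countZeros K m) (leastPeriod≡order*rank leastPeriod)) (countZeros-multiple ω)

module _ (K : ℤ) (n : ℕ) where
  private
    N = suc n
    a = F K (suc N)
    b = F K N

    F[N+jN] : ∀ j → F K (N ℕ.+ j ℕ.* N) ≡ F K (suc (j ℕ.* N)) * b + F K (j ℕ.* N) * F K n
    F[N+jN] j = trans (cong (F K) (ℕ.+-comm N (j ℕ.* N))) (F-+ K (j ℕ.* N) n)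

    F[1+N+jN] : ∀ j → F K (suc (N ℕ.+ j ℕ.* N)) ≡ F K (suc (j ℕ.* N)) * a + F K (j ℕ.* N) * b
    F[1+N+jN] j = trans (cong (F K) (ℕ.+-comm (suc N) (j ℕ.* N))) (F-+ K (j ℕ.* N) N)

  F[1+jN]≡F[1+N]^j : ∀ j → F K (suc (j ℕ.* N)) ≡ a ℤ.^ j mod b
  F[1+jN]≡F[1+N]^j zero    = ≡mod-refl
  F[1+jN]≡F[1+N]^j (suc j) = begin
    F K (suc (N ℕ.+ j ℕ.* N))                          ≡⟨ F[1+N+jN] j ⟩
    F K (suc (j ℕ.* N)) * a + F K (j ℕ.* N) * b        ≈⟨ +-∣≡ _ (∣n⇒∣m*n (F K (j ℕ.* N)) ∣-refl) ⟩
    F K (suc (j ℕ.* N)) * a                            ≈⟨ *-congʳ a (F[1+jN]≡F[1+N]^j j) ⟩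
    a ℤ.^ j * a                                        ≡⟨ ℤ.*-comm (a ℤ.^ j) a ⟩
    a ℤ.^ suc j                                        ∎
    where open ≡mod-Reasoning b

  F[[1+j]N]≡[1+j]F[1+N]^jF[N] : ∀ j → F K (suc j ℕ.* N) ≡ + suc j * a ℤ.^ j * b mod b * b
  F[[1+j]N]≡[1+j]F[1+N]^jF[N] zero    = ≡⇒≡mod (trans (F[N+jN] 0) (identity b (F K n)))
    where
    identity : ∀ b c → + 1 * b + + 0 * c ≡ + 1 * + 1 * b
    identity = solve-∀
  F[[1+j]N]≡[1+j]F[1+N]^jF[N] (suc j) = begin
    F K (N ℕ.+ suc j ℕ.* N)
      ≡⟨ F[N+jN] (suc j) ⟩
    F K (suc (suc j ℕ.* N)) * b + F K (suc j ℕ.* N) * F K n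
      ≈⟨ +-cong (≡mod-scaleʳ b (F[1+jN]≡F[1+N]^j (suc j)))
                (*-congʳ (F K n) (F[[1+j]N]≡[1+j]F[1+N]^jF[N] j)) ⟩
    a ℤ.^ suc j * b + (J * A * b) * F K n
      ≡⟨ identity K b (F K n) A J ⟩
    (+ 1 + J) * a ℤ.^ suc j * b + (- (J * A * K)) * (b * b)
      ≈⟨ +-∣≡ _ (∣n⇒∣m*n (- (J * A * K)) ∣-refl) ⟩
    (+ 1 + J) * a ℤ.^ suc j * b
      ≡⟨ cong (λ i → i * a ℤ.^ suc j * b) (ℤ.pos-+ 1 (suc j)) ⟨
    + suc (suc j) * a ℤ.^ suc j * b
      ∎
    where
    open ≡mod-Reasoning (b * b)
    A = a ℤ.^ j
    J = + suc j
    identity : ∀ K b c A J → ((K * b + c) * A) * b + (J * A * b) * c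
                             ≡ (+ 1 + J) * ((K * b + c) * A) * b + (- (J * A * K)) * (b * b)
    identity = solve-∀

lift-∣F : ∀ K p {n} k → (+ p) ℤ.^ suc k ∣ F K n → (+ p) ℤ.^ suc (suc k) ∣ F K (p ℕ.* n)
lift-∣F K zero              k _ = ∣0
lift-∣F K (suc p′) {zero}  k _ rewrite ℕ.*-zeroʳ p′ = ∣0
lift-∣F K (suc p′) {suc n} k (divides t b≡tPᵏ⁺¹) =
  ∣-resp-≡mod (≡mod-sym (≡mod-weaken Pᵏ⁺²∣b² (F[[1+j]N]≡[1+j]F[1+N]^jF[N] K n p′)))
              Pᵏ⁺²∣pAb
  where
  P = + suc p′
  R = P ℤ.^ k
  A = F K (suc (suc n)) ℤ.^ p′
  b = F K (suc n)
  Pᵏ⁺²∣b² : P ℤ.^ suc (suc k) ∣ b * b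
  Pᵏ⁺²∣b² = divides (t * t * R) (trans (cong₂ _*_ b≡tPᵏ⁺¹ b≡tPᵏ⁺¹) (identity t P R))
    where
    identity : ∀ t P R → (t * (P * R)) * (t * (P * R)) ≡ (t * t * R) * (P * (P * R))
    identity = solve-∀
  Pᵏ⁺²∣pAb : P ℤ.^ suc (suc k) ∣ P * A * b
  Pᵏ⁺²∣pAb = divides (A * t) (trans (cong (P * A *_) b≡tPᵏ⁺¹) (identity t P R A))
    where
    identity : ∀ t P R A → P * A * (t * (P * R)) ≡ (A * t) * (P * (P * R))
    identity = solve-∀

lift-∣F-iterate : ∀ K p {n} k → + p ∣ F K n → (+ p) ℤ.^ suc k ∣ F K (p ^ k ℕ.* n)
lift-∣F-iterate K p {n} zero    p∣Fn =
  subst₂ (λ d i → d ∣ F K i) (sym (ℤ.*-identityʳ (+ p))) (sym (ℕ.*-identityˡ n)) p∣Fn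
lift-∣F-iterate K p {n} (suc k) p∣Fn =
  subst (λ i → (+ p) ℤ.^ suc (suc k) ∣ F K i) (sym (ℕ.*-assoc p (p ^ k) n))
        (lift-∣F K p k (lift-∣F-iterate K p k p∣Fn))

pos-^ : ∀ p k → + (p ^ k) ≡ (+ p) ℤ.^ k
pos-^ p zero    = refl
pos-^ p (suc k) = trans (ℤ.pos-* p (p ^ k)) (cong (+ p *_) (pos-^ p k))

prime∣^⇒∣ : ∀ {q m} → Prime q → ∀ k → q ℕ.∣ m ^ k → q ℕ.∣ m
prime∣^⇒∣ q-prime zero    q∣1 = contradiction (subst Prime (ℕ.∣1⇒≡1 q∣1) q-prime) ¬prime[1]
prime∣^⇒∣ {m = m} q-prime (suc k) q∣mᵏ⁺¹ with euclidsLemma m (m ^ k) q-prime q∣mᵏ⁺¹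
... | inj₁ q∣m  = q∣m
... | inj₂ q∣mᵏ = prime∣^⇒∣ q-prime k q∣mᵏ

prime≢2⇒2∤ : ∀ {p} → Prime p → p ≢ 2 → ¬ (2 ℕ.∣ p)
prime≢2⇒2∤ p-prime p≢2 2∣p with prime⇒irreducible p-prime 2∣p
... | inj₂ 2≡p = p≢2 (sym 2≡p)

prime≢2⇒∤2 : ∀ {p} → Prime p → p ≢ 2 → ¬ (+ p ∣ + 2)
prime≢2⇒∤2 p-prime p≢2 p∣2 with irreducible[2] (∣⇒∣ᵤ p∣2)
... | inj₁ p≡1 = ¬prime[1] (subst Prime p≡1 p-prime)
... | inj₂ p≡2 = p≢2 p≡2

2∤⇒odd : ∀ {i} → ¬ (2 ℕ.∣ i) → ∃[ c ] i ≡ suc (c ℕ.* 2)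
2∤⇒odd {i} 2∤i with i ℕ.% 2 | ℕ.m≡m%n+[m/n]*n i 2 | ℕ.m%n<n i 2
... | 0 | i≡2q     | _ = contradiction (ℕ.divides (i ℕ./ 2) i≡2q) 2∤i
... | 1 | i≡1+2q   | _ = i ℕ./ 2 , i≡1+2q
... | suc (suc _) | _ | s≤s (s≤s ())

rank-quotient-odd : ∀ {K p α β} e → Prime p → p ≢ 2 →
                    IsRankOfApparition K p α → IsRankOfApparition K (p ^ suc e) β →
                    ∃[ c ] β ≡ suc (c ℕ.* 2) ℕ.* α
rank-quotient-odd {K} {p} {α} {β} e p-prime p≢2 rankₚ rank =
  map₂ (λ i≡1+2c → trans β≡iα (cong (ℕ._* α) i≡1+2c)) (2∤⇒odd 2∤i)
  where
  instance _ = ℕ.>-nonZero (IsRankOfApparition.positive rankₚ)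
  α∣β : α ℕ.∣ β
  α∣β = RankOfApparition.∣F⇒∣ rankₚ (∣-trans (∣ᵤ⇒∣ (ℕ.m∣m*n (p ^ e))) (IsRankOfApparition.∣F rank))
  i = ℕ.quotient α∣β
  β≡iα : β ≡ i ℕ.* α
  β≡iα = ℕ._∣_.equality α∣β
  pᵉ⁺¹∣F[pᵉα] : + (p ^ suc e) ∣ F K (p ^ e ℕ.* α)
  pᵉ⁺¹∣F[pᵉα] = subst (_∣ F K (p ^ e ℕ.* α)) (sym (pos-^ p (suc e)))
                  (lift-∣F-iterate K p e (IsRankOfApparition.∣F rankₚ))
  i∣pᵉ : i ℕ.∣ p ^ e
  i∣pᵉ = ℕ.*-cancelʳ-∣ α (subst (ℕ._∣ p ^ e ℕ.* α) β≡iα (RankOfApparition.∣F⇒∣ rank pᵉ⁺¹∣F[pᵉα]))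
  2∤i : ¬ (2 ℕ.∣ i)
  2∤i 2∣i = prime≢2⇒2∤ p-prime p≢2 (prime∣^⇒∣ prime[2] e (ℕ.∣-trans 2∣i i∣pᵉ))

±1-orders : ∀ {d d′ x y} → d′ ∣ d → ¬ (d′ ∣ + 2) → y ≡ x mod d′ →
            x ≡ 1ℤ mod d′ ⊎ x ≡ -1ℤ mod d′ → y ≡ 1ℤ mod d ⊎ y ≡ -1ℤ mod d →
            ∃[ ω ] IsOrder d′ x ω × IsOrder d y ω
±1-orders d′∣d d′∤2 y≡x (inj₁ x≡1)  (inj₁ y≡1)  = 1 , ≡1⇒IsOrder1 x≡1 , ≡1⇒IsOrder1 y≡1
±1-orders d′∣d d′∤2 y≡x (inj₂ x≡-1) (inj₂ y≡-1) =
  2 , ≡-1⇒IsOrder2 d′∤2 x≡-1 , ≡-1⇒IsOrder2 (d′∤2 ∘ ∣-trans d′∣d) y≡-1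
±1-orders d′∣d d′∤2 y≡x (inj₁ x≡1)  (inj₂ y≡-1) =
  contradiction (≡mod-trans (≡mod-sym x≡1) (≡mod-trans (≡mod-sym y≡x) (≡mod-weaken d′∣d y≡-1)))
                (1≢-1 d′∤2)
±1-orders d′∣d d′∤2 y≡x (inj₂ x≡-1) (inj₁ y≡1)  =
  contradiction (≡mod-trans (≡mod-sym (≡mod-weaken d′∣d y≡1)) (≡mod-trans y≡x x≡-1))
                (1≢-1 d′∤2)

common-order : ∀ {K p α β} e c → Prime p → p ≢ 2 →
               IsRankOfApparition K p α → IsRankOfApparition K (p ^ suc e) β →
               β ≡ suc (c ℕ.* 2) ℕ.* α →
               ∃[ ω ] IsOrder (+ p) (F K (suc α)) ω × IsOrder (+ (p ^ suc e)) (F K (suc β)) ω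
common-order {K} {p} {α} {β} e c p-prime p≢2 rankₚ rank β≡iα =
  [ orders-when-α-even , orders-when-α-odd ]′ (-1^n≡1⊎-1^n≡-1 α)
  where
  P = + p
  Q = + (p ^ suc e)
  i = suc (c ℕ.* 2)
  μₚ = F K (suc α)
  μ = F K (suc β)
  s = -1ℤ ℤ.^ α
  P∣Q : P ∣ Q
  P∣Q = ∣ᵤ⇒∣ (ℕ.m∣m*n (p ^ e))
  p∤2 : ¬ (P ∣ + 2)
  p∤2 = prime≢2⇒∤2 p-prime p≢2
  μₚ²≡s : μₚ * μₚ ≡ s mod P
  μₚ²≡s = RankOfApparition.multiplier-square rankₚ
  μ²≡s : μ * μ ≡ s mod Q
  μ²≡s = ≡mod-trans (RankOfApparition.multiplier-square rank)
           (≡⇒≡mod (trans (cong (-1ℤ ℤ.^_) β≡iα) (-1^[odd*n]≡-1^n c α)))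
  μ≡μₚⁱ : μ ≡ μₚ ℤ.^ i mod P
  μ≡μₚⁱ = subst (λ j → F K (suc j) ≡ μₚ ℤ.^ i mod P) (sym β≡iα)
            (RankOfApparition.F[1+jα]≡multiplier^j rankₚ i)

  orders-when-α-odd : s ≡ -1ℤ → ∃[ ω ] IsOrder P μₚ ω × IsOrder Q μ ω
  orders-when-α-odd s≡-1 =
    4 , square≡-1⇒IsOrder4 p∤2 (≡mod-trans μₚ²≡s (≡⇒≡mod s≡-1))
      , square≡-1⇒IsOrder4 (p∤2 ∘ ∣-trans P∣Q) (≡mod-trans μ²≡s (≡⇒≡mod s≡-1))

  orders-when-α-even : s ≡ 1ℤ → ∃[ ω ] IsOrder P μₚ ω × IsOrder Q μ ω
  orders-when-α-even s≡1 = ±1-orders P∣Q p∤2 (≡mod-trans μ≡μₚⁱ (^-odd μₚ²≡1 c)) μₚ≡±1 μ≡±1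
    where
    μₚ²≡1 : μₚ * μₚ ≡ 1ℤ mod P
    μₚ²≡1 = ≡mod-trans μₚ²≡s (≡⇒≡mod s≡1)
    p¹≡p : + (p ^ 1) ≡ P
    p¹≡p = cong +_ (ℕ.*-identityʳ p)
    μₚ≡±1 : μₚ ≡ 1ℤ mod P ⊎ μₚ ≡ -1ℤ mod P
    μₚ≡±1 = subst (λ d → μₚ ≡ 1ℤ mod d ⊎ μₚ ≡ -1ℤ mod d) p¹≡p
              (square≡1⇒≡±1 p-prime p∤2 1 (subst (μₚ * μₚ ≡ 1ℤ mod_) (sym p¹≡p) μₚ²≡1))
    μ≡±1 : μ ≡ 1ℤ mod Q ⊎ μ ≡ -1ℤ mod Q
    μ≡±1 = square≡1⇒≡±1 p-prime p∤2 (suc e) (≡mod-trans μ²≡s (≡⇒≡mod s≡1))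

theorem4p21 : (K : ℤ) (e p : ℕ) → e > 0 → Prime p → p ≢ 2 →
              .{{_ : NonZero p}} .{{_ : NonZero (p ^ e)}} →
              (πpe πp : ℕ) → IsLeastPeriod K (p ^ e) πpe → IsLeastPeriod K p πp →
              countZeros K (p ^ e) πpe ≡ countZeros K p πp
theorem4p21 K zero    p ()
theorem4p21 K (suc e) p _ p-prime p≢2 πpe πp leastₚₑ leastₚ =
  let α , rankₚ              = period⇒rankOfApparition (proj₁ leastₚ)
      β , rankₚₑ             = period⇒rankOfApparition (proj₁ leastₚₑ)
      c , β≡[1+2c]α          = rank-quotient-odd e p-prime p≢2 rankₚ rankₚₑ
      ω , orderₚ , orderₚₑ   = common-order e c p-prime p≢2 rankₚ rankₚₑ β≡[1+2c]α
  in trans (RankOfApparition.zeros-per-period rankₚₑ orderₚₑ leastₚₑ)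
           (sym (RankOfApparition.zeros-per-period rankₚ orderₚ leastₚ))
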